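{- Let $m\ge 1$ and let $y=(y_0,\dots,y_m)\in X_{\mathbb{F}_2}(m)$ be such that $y_i=\mathbf{1}$ for at least one $i$. Then $\#c^{ -1}(y)=1$ if and only if there exists $i\in\{0,\dots,m\}$ such that $y_i\neq y_j$ for every $j\neq i$.
   Context: $\mathbb{F}_2\mathbb{P}^1=\{\mathbf{0}=[1:0],\mathbf{1}=[1:1],\infty=[0:1]\}$. $X_{\mathbb{F}_2}(m)$ is the set of $(y_0,\dots,y_m)\in(\mathbb{F}_2\mathbb{P}^1)^{m+1}$ with $y_0=\mathbf{0}$, $y_m=\infty$, $y_i\neq y_{i+1}$ for $0\le i\le m-1$. $P_{m+1}$ is a convex polygon with vertices $0,\dots,m$ in clockwise order. The map $c$ from the set of triangulations of $P_{m+1}$ to $X_{\mathbb{F}_2}(m)$ sends $T$ to the unique $(y_0,\dots,y_m)$ with $y_0=\mathbf{0}$, $y_m=\infty$ and $y_k\neq y_l$ whenever $kl$ is a side of $P_{m+1}$ or a diagonal of $T$. -}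

module Defs where

open import Data.Nat using (ℕ; zero; suc; _+_; _<_; _≤_)
open import Data.Fin using (Fin; toℕ; fromℕ; inject₁) renaming (zero to fzero; suc to fsuc)
open import Data.Bool using (Bool; true)
open import Data.Product using (Σ; _×_; ∃)
open import Data.Sum using (_⊎_)
open import Relation.Binary.PropositionalEquality using (_≡_; _≢_)
open import Relation.Nullary using (¬_)

-- The projective line over F₂: 𝟎 = [1:0], 𝟏 = [1:1], ∞ = [0:1].
data F2P1 : Set where
  𝟎 𝟏 ∞ : F2P1

record X (m : ℕ) : Set where
  field
    y       : Fin (suc m) → F2P1
    y-first : y fzero ≡ 𝟎
    y-last  : y (fromℕ m) ≡ ∞
    y-adj   : (i : Fin m) → y (inject₁ i) ≢ y (fsuc i)

-- Polygon P_{m+1} with vertices 0,…,m.  A diagonal is a pair k < l of vertices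
-- that is not a side, i.e. l ≥ k + 2 and (k,l) ≠ (0,m).
IsDiagonal : (m : ℕ) → Fin (suc m) → Fin (suc m) → Set
IsDiagonal m k l = (2 + toℕ k ≤ toℕ l) × ¬ (toℕ k ≡ 0 × toℕ l ≡ m)

Crosses : {m : ℕ} → Fin (suc m) → Fin (suc m) → Fin (suc m) → Fin (suc m) → Set
Crosses k l k' l' =
  (toℕ k < toℕ k' × toℕ k' < toℕ l × toℕ l < toℕ l')
  ⊎ (toℕ k' < toℕ k × toℕ k < toℕ l' × toℕ l' < toℕ l)

DiagSet : ℕ → Set
DiagSet m = Fin (suc m) → Fin (suc m) → Bool

record IsTriangulation (m : ℕ) (T : DiagSet m) : Set where
  field
    only-diagonals : ∀ k l → T k l ≡ true → IsDiagonal m k l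
    non-crossing   : ∀ k l k' l' → T k l ≡ true → T k' l' ≡ true → ¬ Crosses k l k' l'
    maximal        : ∀ k l → IsDiagonal m k l → ¬ (T k l ≡ true) →
                     ∃ λ k' → ∃ λ l' → T k' l' ≡ true × Crosses k l k' l'

SameTriangulation : {m : ℕ} → DiagSet m → DiagSet m → Set
SameTriangulation T T' = ∀ k l → T k l ≡ T' k l

-- c(T) = y: y₀ = 𝟎, y_m = ∞ and y_k ≠ y_l whenever kl is a side or a diagonal of T.
-- (Sides (i,i+1) and (0,m) are handled by the defining conditions of X(m).)
MapsTo : {m : ℕ} → DiagSet m → X m → Set
MapsTo T x = ∀ k l → T k l ≡ true → X.y x k ≢ X.y x l

InFiber : {m : ℕ} → X m → DiagSet m → Set
InFiber x T = IsTriangulation _ T × MapsTo T x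

FiberHasOneElement : {m : ℕ} → X m → Set
FiberHasOneElement x =
  (∃ λ T → InFiber x T) ×
  (∀ T T' → InFiber x T → InFiber x T' → SameTriangulation T T')

module Submission where

-- Elements of c⁻¹(y) are binary trees: the triangle (a, q, b) on a base ab, with triangulations of
-- a, …, q and q, …, b glued to it, every triangle carrying all three colours.  The apex on a base whose
-- ends have colours c, c′ must have the third colour.
--
-- If i is the only vertex of its colour, a diagonal kl of such a triangulation has an apex on each
-- side; if i ∉ {k, l} both apexes would have the colour of i, hence both be i.  So every element of
-- the fiber is the fan at i, and the vertex coloured 𝟏 gives existence.
--
-- If every colour occurs twice, let f and l be the first and last vertex of the colour missing at
-- a and b.  Either both are possible apexes of the base ab, giving two triangulations, or one end of
-- the polygon is an ear of every proper triangulation and can be cut off, keeping every colour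
-- twice; recurse.

open import Defs
open import Data.Nat using (ℕ; zero; suc; _+_; _<_; _≤_; z≤n; s≤s; _≤?_; _<?_; _≟_)
open import Data.Nat.Properties
open import Data.Bool using (true; false)
open import Data.Bool.Properties using (⇔→≡)
open import Data.Product using (Σ; ∃; ∃₂; _×_; _,_; proj₁; proj₂)
open import Data.Sum using (_⊎_; inj₁; inj₂; [_,_]′) renaming (map to ⊎-map)
open import Data.Empty using (⊥; ⊥-elim)
open import Data.Unit using (tt)
open import Function using (_∘_)
open import Function.Bundles using (_⇔_; mk⇔)
open import Relation.Binary.Definitions using (DecidableEquality; tri<; tri≈; tri>)
open import Relation.Binary.PropositionalEquality
open import Relation.Nullary using (¬_; Dec; yes; no; does; contradiction)
open import Relation.Nullary.Decidable using (map′; _×-dec_; _→-dec_; ¬?; toWitness; dec-true)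
open import Relation.Unary using (Decidable)
open import Data.Fin using (Fin; toℕ; fromℕ; fromℕ<; inject₁) renaming (zero to fzero; suc to fsuc)
import Data.Fin.Properties as Fin

private variable
  a b p q k j k′ j′ : ℕ

_≟ᶜ_ : DecidableEquality F2P1
𝟎 ≟ᶜ 𝟎 = yes refl
𝟎 ≟ᶜ 𝟏 = no λ ()
𝟎 ≟ᶜ ∞ = no λ ()
𝟏 ≟ᶜ 𝟎 = no λ ()
𝟏 ≟ᶜ 𝟏 = yes refl
𝟏 ≟ᶜ ∞ = no λ ()
∞ ≟ᶜ 𝟎 = no λ ()
∞ ≟ᶜ 𝟏 = no λ ()
∞ ≟ᶜ ∞ = yes refl

∀ᶜ? : {P : F2P1 → Set} → Decidable P → Dec (∀ c → P c)
∀ᶜ? P? = map′ (λ (p₀ , p₁ , p∞) → λ { 𝟎 → p₀ ; 𝟏 → p₁ ; ∞ → p∞ }) (λ p → p 𝟎 , p 𝟏 , p ∞)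
              (P? 𝟎 ×-dec P? 𝟏 ×-dec P? ∞)

third-colour-unique : ∀ {c c′ x z : F2P1} → c ≢ c′ → x ≢ c → x ≢ c′ → z ≢ c → z ≢ c′ → x ≡ z
third-colour-unique {c} {c′} {x} {z} = toWitness {a? = check} tt c c′ x z
  where
  avoid? : ∀ c c′ x z → Dec (c ≢ c′ → x ≢ c → x ≢ c′ → z ≢ c → z ≢ c′ → x ≡ z)
  avoid? c c′ x z = ¬? (c ≟ᶜ c′) →-dec ¬? (x ≟ᶜ c) →-dec ¬? (x ≟ᶜ c′) →-dec ¬? (z ≟ᶜ c) →-dec ¬? (z ≟ᶜ c′)
                    →-dec (x ≟ᶜ z)
  check = ∀ᶜ? λ c → ∀ᶜ? λ c′ → ∀ᶜ? λ x → ∀ᶜ? λ z → avoid? c c′ x z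

module _ {P : ℕ → Set} (P? : Decidable P) where

  first-below : ∀ n → (∃ λ k → k < n × P k × (∀ j → j < k → ¬ P j)) ⊎ (∀ k → k < n → ¬ P k)
  first-below zero = inj₂ λ _ ()
  first-below (suc n) with first-below n
  ... | inj₁ (k , k<n , Pk , before) = inj₁ (k , m<n⇒m<1+n k<n , Pk , before)
  ... | inj₂ none with P? n
  ...   | yes Pn = inj₁ (n , n<1+n n , Pn , none)
  ...   | no ¬Pn = inj₂ λ k k<1+n → [ none k , (λ { refl → ¬Pn }) ]′ (m<1+n⇒m<n∨m≡n k<1+n)

  last-below : ∀ n → (∃ λ k → k < n × P k × (∀ j → k < j → j < n → ¬ P j)) ⊎ (∀ k → k < n → ¬ P k)
  last-below zero = inj₂ λ _ ()
  last-below (suc n) with P? n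
  ... | yes Pn = inj₁ (n , n<1+n n , Pn , λ j n<j j<1+n → contradiction n<j (≤⇒≯ (≤-pred j<1+n)))
  ... | no ¬Pn with last-below n
  ...   | inj₁ (k , k<n , Pk , after) =
          inj₁ (k , m<n⇒m<1+n k<n , Pk ,
                λ j k<j j<1+n → [ after j k<j , (λ { refl → ¬Pn }) ]′ (m<1+n⇒m<n∨m≡n j<1+n))
  ...   | inj₂ none = inj₂ λ k k<1+n → [ none k , (λ { refl → ¬Pn }) ]′ (m<1+n⇒m<n∨m≡n k<1+n)

Crossing : ℕ → ℕ → ℕ → ℕ → Set
Crossing k j k′ j′ = (k < k′ × k′ < j × j < j′) ⊎ (k′ < k × k < j′ × j′ < j)

Diagonal : ℕ → ℕ → ℕ → Set
Diagonal m k j = 2 + k ≤ j × ¬ (k ≡ 0 × j ≡ m)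

crossing-sym : Crossing k j k′ j′ → Crossing k′ j′ k j
crossing-sym (inj₁ c) = inj₂ c
crossing-sym (inj₂ c) = inj₁ c

nested-noncrossing : a ≤ k → j ≤ b → ¬ Crossing a b k j
nested-noncrossing a≤k j≤b (inj₁ (_ , _ , b<j)) = ≤⇒≯ j≤b b<j
nested-noncrossing a≤k j≤b (inj₂ (k<a , _ , _)) = ≤⇒≯ a≤k k<a

disjoint-noncrossing : k < j → j ≤ k′ → ¬ Crossing k j k′ j′
disjoint-noncrossing k<j j≤k′ (inj₁ (_ , k′<j , _)) = ≤⇒≯ j≤k′ k′<j
disjoint-noncrossing k<j j≤k′ (inj₂ (k′<k , _ , _)) = ≤⇒≯ j≤k′ (<-trans k′<k k<j)

crossing-endpoints-distinct : Crossing k j k′ j′ → k ≢ k′ × k ≢ j′ × j ≢ k′ × j ≢ j′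
crossing-endpoints-distinct (inj₁ (k<k′ , k′<j , j<j′)) =
  <⇒≢ k<k′ , <⇒≢ (<-trans k<k′ (<-trans k′<j j<j′)) , ≢-sym (<⇒≢ k′<j) , <⇒≢ j<j′
crossing-endpoints-distinct (inj₂ (k′<k , k<j′ , j′<j)) =
  ≢-sym (<⇒≢ k′<k) , <⇒≢ k<j′ , ≢-sym (<⇒≢ (<-trans k′<k (<-trans k<j′ j′<j))) , ≢-sym (<⇒≢ j′<j)

crossing-no-common-endpoint : Crossing k j k′ j′ → k ≡ p ⊎ j ≡ p → ¬ (k′ ≡ p ⊎ j′ ≡ p)
crossing-no-common-endpoint cross k∣j≡p k′∣j′≡p with crossing-endpoints-distinct cross
crossing-no-common-endpoint _ (inj₁ refl) (inj₁ k′≡k) | k≢k′ , _ = k≢k′ (sym k′≡k)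
crossing-no-common-endpoint _ (inj₁ refl) (inj₂ j′≡k) | _ , k≢j′ , _ = k≢j′ (sym j′≡k)
crossing-no-common-endpoint _ (inj₂ refl) (inj₁ k′≡j) | _ , _ , j≢k′ , _ = j≢k′ (sym k′≡j)
crossing-no-common-endpoint _ (inj₂ refl) (inj₂ j′≡j) | _ , _ , _ , j≢j′ = j≢j′ (sym j′≡j)

crossing-diagonal : ∀ {m} → Crossing k j k′ j′ → j ≤ m → Diagonal m k′ j′
crossing-diagonal (inj₁ (k<k′ , k′<j , j<j′)) _ =
  ≤-trans (s≤s k′<j) j<j′ , λ { (refl , _) → contradiction k<k′ λ () }
crossing-diagonal (inj₂ (k′<k , k<j′ , j′<j)) j≤m =
  ≤-trans (s≤s k′<k) k<j′ , λ { (_ , refl) → ≤⇒≯ j≤m j′<j }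

-- A triangulation of the polygon with vertices a, a+1, …, b: the triangle (a, q, b) on the base ab
-- together with triangulations of a, …, q and of q, …, b.
data Triangulation : ℕ → ℕ → Set where
  edge : Triangulation a (suc a)
  join : Triangulation a q → Triangulation q b → Triangulation a b

data Arc : Triangulation a b → ℕ → ℕ → Set where
  base  : {t : Triangulation a b} → Arc t a b
  left  : {l : Triangulation a q} {r : Triangulation q b} → Arc l k j → Arc (join l r) k j
  right : {l : Triangulation a q} {r : Triangulation q b} → Arc r k j → Arc (join l r) k j

arc? : (t : Triangulation a b) (k j : ℕ) → Dec (Arc t k j)
arc? {a} {b} t k j with (k ≟ a) ×-dec (j ≟ b)
arc? t k j | yes (refl , refl) = yes base
arc? edge k j | no ¬base = no λ { base → ¬base (refl , refl) }
arc? (join l r) k j | no ¬base with arc? l k j | arc? r k j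
... | yes c | _ = yes (left c)
... | no _ | yes c = yes (right c)
... | no ¬l | no ¬r = no λ { base → ¬base (refl , refl) ; (left c) → ¬l c ; (right c) → ¬r c }

base< : Triangulation a b → a < b
base< edge       = n<1+n _
base< (join l r) = <-trans (base< l) (base< r)

arc-bounds : {t : Triangulation a b} → Arc t k j → a ≤ k × k < j × j ≤ b
arc-bounds {t = t} base = ≤-refl , base< t , ≤-refl
arc-bounds {t = join l r} (left c) =
  let (a≤k , k<j , j≤q) = arc-bounds c in a≤k , k<j , ≤-trans j≤q (<⇒≤ (base< r))
arc-bounds {t = join l r} (right c) =
  let (q≤k , k<j , j≤b) = arc-bounds c in ≤-trans (<⇒≤ (base< l)) q≤k , k<j , j≤b

arcs-noncrossing : {t : Triangulation a b} → Arc t k j → Arc t k′ j′ → ¬ Crossing k j k′ j′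
arcs-noncrossing base c′ = let (a≤k′ , _ , j′≤b) = arc-bounds c′ in nested-noncrossing a≤k′ j′≤b
arcs-noncrossing c base =
  let (a≤k , _ , j≤b) = arc-bounds c in nested-noncrossing a≤k j≤b ∘ crossing-sym
arcs-noncrossing (left c)  (left c′)  = arcs-noncrossing c c′
arcs-noncrossing (right c) (right c′) = arcs-noncrossing c c′
arcs-noncrossing (left c) (right c′) =
  let (_ , k<j , j≤q) = arc-bounds c ; (q≤k′ , _ , _) = arc-bounds c′
  in disjoint-noncrossing k<j (≤-trans j≤q q≤k′)
arcs-noncrossing (right c) (left c′) =
  let (q≤k , _ , _) = arc-bounds c ; (_ , k′<j′ , j′≤q) = arc-bounds c′
  in disjoint-noncrossing k′<j′ (≤-trans j′≤q q≤k) ∘ crossing-sym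

arcs-maximal : (t : Triangulation a b) → a ≤ k → k < j → j ≤ b →
               Arc t k j ⊎ ∃₂ λ k′ j′ → Arc t k′ j′ × Crossing k j k′ j′
arcs-maximal {a = a} {k = k} {j = j} edge a≤k k<j j≤1+a = inj₁ (subst₂ (Arc edge) (sym k≡a) (sym j≡1+a) base)
  where
  k≡a : k ≡ a
  k≡a = ≤-antisym (≤-pred (<-≤-trans k<j j≤1+a)) a≤k
  j≡1+a : j ≡ suc a
  j≡1+a = ≤-antisym j≤1+a (subst (_< j) k≡a k<j)
arcs-maximal {a = a} {k = k} {j = j} (join {q = q} {b = b} l r) a≤k k<j j≤b with j ≤? q | q ≤? k
... | yes j≤q | _ = ⊎-map left (λ (k′ , j′ , c , x) → k′ , j′ , left c , x) (arcs-maximal l a≤k k<j j≤q)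
... | no _ | yes q≤k = ⊎-map right (λ (k′ , j′ , c , x) → k′ , j′ , right c , x) (arcs-maximal r q≤k k<j j≤b)
... | no j≰q | no q≰k with k ≟ a | j ≟ b
...   | yes refl | yes refl = inj₁ base
...   | yes refl | no j≢b = inj₂ (q , b , right base , inj₁ (≰⇒> q≰k , ≰⇒> j≰q , ≤∧≢⇒< j≤b j≢b))
...   | no k≢a | _ = inj₂ (a , q , left base , inj₂ (≤∧≢⇒< a≤k (≢-sym k≢a) , ≰⇒> q≰k , ≰⇒> j≰q))

module Colouring (Y : ℕ → F2P1) where

  Proper : Triangulation a b → Set
  Proper t = ∀ {k j} → Arc t k j → Y k ≢ Y j

  record Third (a b p : ℕ) : Set where
    constructor between
    field
      a<p   : a < p
      p<b   : p < b
      Yp≢Ya : Y p ≢ Y a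
      Yp≢Yb : Y p ≢ Y b

  -- Exactly what a, …, b needs to have a proper triangulation (when Y a ≢ Y b).
  Good : ℕ → ℕ → Set
  Good a b = b ≡ suc a ⊎ ∃ (Third a b)

  proper-edge : Y a ≢ Y (suc a) → Proper (edge {a})
  proper-edge Ya≢Y1+a base = Ya≢Y1+a

  proper-join : {l : Triangulation a q} {r : Triangulation q b} →
                Y a ≢ Y b → Proper l → Proper r → Proper (join l r)
  proper-join Ya≢Yb _ _ base = Ya≢Yb
  proper-join _ proper-l _ (left c)  = proper-l c
  proper-join _ _ proper-r (right c) = proper-r c

  inner-third : {t : Triangulation a b} → Proper t → Arc t k j → 2 + k ≤ j → ∃ (Third k j)
  inner-third {t = edge} _ base 2+a≤1+a = contradiction (≤-pred 2+a≤1+a) (1+n≰n)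
  inner-third {t = join {q = q} l r} proper base _ =
    q , between (base< l) (base< r) (≢-sym (proper (left base))) (proper (right base))
  inner-third proper (left c)  = inner-third (proper ∘ left) c
  inner-third proper (right c) = inner-third (proper ∘ right) c

  outer-third : {t : Triangulation a b} → Proper t → Arc t k j → ¬ (k ≡ a × j ≡ b) →
                ∃ λ p → p ≤ b × (p < k ⊎ j < p) × Y p ≢ Y k × Y p ≢ Y j
  outer-third _ base not-base = contradiction (refl , refl) not-base
  outer-third {k = k} {j = j} {t = join {a} {q} {b} l r} proper (left c) _ with (k ≟ a) ×-dec (j ≟ q)
  ... | yes (refl , refl) = b , ≤-refl , inj₂ (base< r) , ≢-sym (proper base) , ≢-sym (proper (right base))
  ... | no not-base = let (p , p≤q , outside , colours) = outer-third (proper ∘ left) c not-base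
                      in p , ≤-trans p≤q (<⇒≤ (base< r)) , outside , colours
  outer-third {k = k} {j = j} {t = join {a} {q} {b} l r} proper (right c) _ with (k ≟ q) ×-dec (j ≟ b)
  ... | yes (refl , refl) =
        a , <⇒≤ (<-trans (base< l) (base< r)) , inj₁ (base< l) , proper (left base) , proper base
  ... | no not-base = outer-third (proper ∘ right) c not-base

  module Fan {m i : ℕ} (unique : ∀ n → n ≤ m → Y n ≡ Y i → n ≡ i) where

    -- The third colour at the apex inside a diagonal and at the one outside must both be Y i.
    arcs-through : {t : Triangulation 0 m} → Proper t → Arc t k j → Diagonal m k j → k ≡ i ⊎ j ≡ i
    arcs-through {k = k} {j = j} proper c (2+k≤j , not-outer) with arc-bounds c | k ≟ i | j ≟ i
    ... | _ | yes k≡i | _ = inj₁ k≡i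
    ... | _ | no _ | yes j≡i = inj₂ j≡i
    ... | _ , k<j , j≤m | no k≢i | no j≢i =
          ⊥-elim (apex-clash (inner-third proper c 2+k≤j) (outer-third proper c not-outer))
      where
      k≤m = ≤-trans (<⇒≤ k<j) j≤m
      coloured-i : ∀ {n} → n ≤ m → Y n ≢ Y k → Y n ≢ Y j → n ≡ i
      coloured-i {n} n≤m Yn≢Yk Yn≢Yj = unique n n≤m (third-colour-unique (proper c) Yn≢Yk Yn≢Yj
                                                        (λ e → k≢i (unique k k≤m (sym e)))
                                                        (λ e → j≢i (unique j j≤m (sym e))))
      apex-clash : ∃ (Third k j) → (∃ λ p → p ≤ m × (p < k ⊎ j < p) × Y p ≢ Y k × Y p ≢ Y j) → ⊥
      apex-clash (p , between k<p p<j Yp≢Yk Yp≢Yj) (p′ , p′≤m , outside , Yp′≢Yk , Yp′≢Yj)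
        with coloured-i (≤-trans (<⇒≤ p<j) j≤m) Yp≢Yk Yp≢Yj | coloured-i p′≤m Yp′≢Yk Yp′≢Yj
      ... | refl | refl = [ (λ p<k → <-asym p<k k<p) , (λ j<p → <-asym j<p p<j) ]′ outside

    diagonal-arcs-agree : {t t′ : Triangulation 0 m} → Proper t → Proper t′ →
                          Arc t k j → Diagonal m k j → Arc t′ k j
    diagonal-arcs-agree {t′ = t′} proper proper′ c diag with arc-bounds c
    ... | _ , k<j , j≤m with arcs-maximal t′ z≤n k<j j≤m
    ...   | inj₁ c′ = c′
    ...   | inj₂ (_ , _ , c′ , cross) =
            contradiction (arcs-through proper′ c′ (crossing-diagonal cross j≤m))
                          (crossing-no-common-endpoint cross (arcs-through proper c diag))

size-left : b ≤ suc k + a → q < b → q ≤ k + a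
size-left bound q<b = ≤-pred (≤-trans q<b bound)

size-right : b ≤ suc k + a → a < q → b ≤ k + q
size-right {k = k} {a = a} bound a<q =
  ≤-trans bound (≤-trans (≤-reflexive (sym (+-suc k a))) (+-monoʳ-≤ k a<q))

module ProperColouring {m : ℕ} (Y : ℕ → F2P1) (adjacent : ∀ n → n < m → Y n ≢ Y (suc n)) where
  open Colouring Y

  first-of-colour : a < p → ∃ λ f → a < f × f ≤ p × Y f ≡ Y p × (∀ x → a < x → x < f → Y x ≢ Y p)
  first-of-colour {a} {p} a<p with first-below (λ x → (a <? x) ×-dec (Y x ≟ᶜ Y p)) (suc p)
  ... | inj₁ (f , f<1+p , (a<f , Yf≡Yp) , before) =
        f , a<f , ≤-pred f<1+p , Yf≡Yp , λ x a<x x<f Yx≡Yp → before x x<f (a<x , Yx≡Yp)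
  ... | inj₂ none = contradiction (a<p , refl) (none p (n<1+n p))

  last-of-colour : p < b → ∃ λ l → p ≤ l × l < b × Y l ≡ Y p × (∀ x → l < x → x < b → Y x ≢ Y p)
  last-of-colour {p} {b} p<b with last-below (λ x → (p ≤? x) ×-dec (Y x ≟ᶜ Y p)) b
  ... | inj₁ (l , l<b , (p≤l , Yl≡Yp) , after) =
        l , p≤l , l<b , Yl≡Yp , λ x l<x x<b Yx≡Yp → after x l<x x<b (≤-trans p≤l (<⇒≤ l<x) , Yx≡Yp)
  ... | inj₂ none = contradiction (≤-refl , refl) (none p p<b)

  colour-between? : ∀ c lo hi → (∃ λ r → lo < r × r < hi × Y r ≡ c) ⊎ (∀ r → lo < r → r < hi → Y r ≢ c)
  colour-between? c lo hi with first-below (λ r → (lo <? r) ×-dec (Y r ≟ᶜ c)) hi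
  ... | inj₁ (r , r<hi , (lo<r , Yr≡c) , _) = inj₁ (r , lo<r , r<hi , Yr≡c)
  ... | inj₂ none = inj₂ λ r lo<r r<hi Yr≡c → none r r<hi (lo<r , Yr≡c)

  good-up-to-first : a < q → q ≤ m → (∀ x → a < x → x < q → Y x ≢ Y q) → Good a q
  good-up-to-first {a} {q} a<q q≤m before with q ≟ suc a
  ... | yes q≡1+a = inj₁ q≡1+a
  ... | no q≢1+a = inj₂ (suc a , between (n<1+n a) 1+a<q (≢-sym (adjacent a (<-≤-trans a<q q≤m)))
                                          (before (suc a) (n<1+n a) 1+a<q))
    where
    1+a<q = ≤∧≢⇒< a<q (≢-sym q≢1+a)

  good-from-last : q < b → b ≤ m → (∀ x → q < x → x < b → Y x ≢ Y q) → Good q b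
  good-from-last {q} {suc b′} q<b b≤m after with b′ ≟ q
  ... | yes refl = inj₁ refl
  ... | no b′≢q = inj₂ (b′ , between q<b′ (n<1+n b′) (after b′ q<b′ (n<1+n b′)) (adjacent b′ b≤m))
    where
    q<b′ = ≤∧≢⇒< (≤-pred q<b) (≢-sym b′≢q)

  -- If no vertex after a third-coloured q has the colour of a, then the colours from q on alternate
  -- between those of q and b.
  no-colour-after : suc b ≤ m → Y a ≢ Y (suc b) → Third a (suc b) q → q < b →
                    (∀ r → q < r → r < suc b → Y r ≢ Y a) → Y b ≡ Y q × Third a b (suc q)
  no-colour-after {b} {a} {q} b<m Ya≢Y1+b (between a<q _ Yq≢Ya Yq≢Y1+b) q<b no-a =
    Yb≡Yq , between (<-trans a<q (n<1+n q)) 1+q<b (no-a (suc q) (n<1+n q) (<-trans 1+q<b (n<1+n b)))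
                    (λ e → Y1+q≢Yq (trans e Yb≡Yq))
    where
    Yb≡Yq = third-colour-unique Ya≢Y1+b (no-a b q<b (n<1+n b)) (adjacent b b<m) Yq≢Ya Yq≢Y1+b
    Y1+q≢Yq = ≢-sym (adjacent q (<-trans q<b b<m))
    1+q<b = ≤∧≢⇒< q<b (λ e → Y1+q≢Yq (trans (cong Y e) Yb≡Yq))

  no-colour-before : b ≤ m → Y a ≢ Y b → Third a b p → suc a < p → (∀ s → a < s → s < p → Y s ≢ Y b) →
                     Y (suc a) ≡ Y p × ∃ λ q → q < p × Third (suc a) b q
  no-colour-before {p = zero} _ _ _ () _
  no-colour-before {b} {a} {suc q} b≤m Ya≢Yb (between _ 1+q<b Yp≢Ya Yp≢Yb) 1+a<p no-b =
    Y1+a≡Yp , q , n<1+n q ,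
    between 1+a<q (<-trans (n<1+n q) 1+q<b) (λ e → Yq≢Yp (trans e Y1+a≡Yp)) (no-b q a<q (n<1+n q))
    where
    q<m = <-≤-trans (<-trans (n<1+n q) 1+q<b) b≤m
    Yq≢Yp = adjacent q q<m
    a<q = ≤-pred 1+a<p
    Y1+a≡Yp = third-colour-unique Ya≢Yb (≢-sym (adjacent a (<-trans a<q q<m))) (no-b (suc a) (n<1+n a) 1+a<p)
                                  Yp≢Ya Yp≢Yb
    1+a<q = ≤∧≢⇒< a<q (λ e → Yq≢Yp (trans (cong Y (sym e)) Y1+a≡Yp))

  -- The first vertex q of the third colour always has a good left side; if its right side is not good,
  -- the vertex just before b is a good apex instead.
  good-apex : b ≤ m → Y a ≢ Y b → ∃ (Third a b) → ∃ λ q → Third a b q × Good a q × Good q b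
  good-apex {zero} _ _ (_ , between _ () _ _)
  good-apex {suc b′} {a} b≤m Ya≢Yb (p , between a<p p<b Yp≢Ya Yp≢Yb) =
    let (q , a<q , q≤p , Yq≡Yp , before) = first-of-colour a<p
        q<b = ≤-<-trans q≤p p<b
    in apex-from a<q q<b (λ e → Yp≢Ya (trans (sym Yq≡Yp) e)) (λ e → Yp≢Yb (trans (sym Yq≡Yp) e))
         (good-up-to-first a<q (≤-trans (<⇒≤ q<b) b≤m) λ x a<x x<q e → before x a<x x<q (trans e Yq≡Yp))
    where
    apex-from : a < q → q < suc b′ → Y q ≢ Y a → Y q ≢ Y (suc b′) → Good a q →
                ∃ λ q → Third a (suc b′) q × Good a q × Good q (suc b′)
    apex-from {q} a<q q<b Yq≢Ya Yq≢Yb good-a-q with colour-between? (Y a) q (suc b′)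
    ... | inj₁ (r , q<r , r<b , Yr≡Ya) =
          q , between a<q q<b Yq≢Ya Yq≢Yb , good-a-q ,
          inj₂ (r , between q<r r<b (λ e → Yq≢Ya (trans (sym e) Yr≡Ya)) (λ e → Ya≢Yb (trans (sym Yr≡Ya) e)))
    apex-from {q} a<q q<b Yq≢Ya Yq≢Yb good-a-q | inj₂ no-a with q ≟ b′
    ... | yes refl = q , between a<q q<b Yq≢Ya Yq≢Yb , good-a-q , inj₁ refl
    ... | no q≢b′ =
          let q<b′ = ≤∧≢⇒< (≤-pred q<b) q≢b′
              (_ , third-a-b′) = no-colour-after b≤m Ya≢Yb (between a<q q<b Yq≢Ya Yq≢Yb) q<b′ no-a
          in b′ , between (<-trans a<q q<b′) (n<1+n b′) (no-a b′ q<b′ (n<1+n b′)) (adjacent b′ b≤m) ,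
             inj₂ (suc q , third-a-b′) , inj₁ refl

  proper-triangulation : a < b → b ≤ m → Y a ≢ Y b → Good a b → Σ (Triangulation a b) Proper
  proper-triangulation {a} {b} = sized b (m≤m+n b a)
    where
    sized : ∀ {a b} n → b ≤ n + a → a < b → b ≤ m → Y a ≢ Y b → Good a b → Σ (Triangulation a b) Proper
    sized zero b≤a a<b _ _ _ = contradiction b≤a (<⇒≱ a<b)
    sized (suc n) _ _ _ Ya≢Y1+a (inj₁ refl) = edge , proper-edge Ya≢Y1+a
    sized (suc n) bound a<b b≤m Ya≢Yb (inj₂ third) with good-apex b≤m Ya≢Yb third
    ... | q , between a<q q<b Yq≢Ya Yq≢Yb , good-a-q , good-q-b =
          let (l , proper-l) = sized n (size-left {k = n} bound q<b) a<q (≤-trans (<⇒≤ q<b) b≤m)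
                                     (≢-sym Yq≢Ya) good-a-q
              (r , proper-r) = sized n (size-right {k = n} bound a<q) q<b b≤m Yq≢Yb good-q-b
          in join l r , proper-join Ya≢Yb proper-l proper-r

  record TwoTriangulations (a b : ℕ) : Set where
    field
      t₁ t₂   : Triangulation a b
      proper₁ : Proper t₁
      proper₂ : Proper t₂
      lo hi   : ℕ
      long    : 2 + lo ≤ hi
      arc₁    : Arc t₁ lo hi
      ¬arc₂   : ¬ Arc t₂ lo hi

  Twins : ℕ → ℕ → Set
  Twins a b = ∀ x → a ≤ x → x ≤ b → ∃ λ x′ → a ≤ x′ × x′ ≤ b × x′ ≢ x × Y x′ ≡ Y x

  record Twinned (a b : ℕ) : Set where
    field
      ends-differ : Y a ≢ Y b
      third       : ∃ (Third a b)
      twins       : Twins a b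

  record Extremes (a b : ℕ) : Set where
    field
      f l      : ℕ
      third-f  : Third a b f
      third-l  : Third a b l
      f<l      : f < l
      before-f : ∀ x → a < x → x < f → Y x ≢ Y f
      after-l  : ∀ x → l < x → x < b → Y x ≢ Y l

  twinned-< : Twinned a b → a < b
  twinned-< record { third = _ , between a<p p<b _ _ } = <-trans a<p p<b

  extremes : Twinned a b → Extremes a b
  extremes {a} {b} tw with Twinned.third tw
  ... | p , between a<p p<b Yp≢Ya Yp≢Yb with first-of-colour a<p | last-of-colour p<b
  ... | f , a<f , f≤p , Yf≡Yp , before | l , p≤l , l<b , Yl≡Yp , after = record
    { f = f ; l = l
    ; third-f = between a<f (≤-<-trans f≤p p<b) (recolour Yf≡Yp Yp≢Ya) (recolour Yf≡Yp Yp≢Yb)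
    ; third-l = between (<-≤-trans a<p p≤l) l<b (recolour Yl≡Yp Yp≢Ya) (recolour Yl≡Yp Yp≢Yb)
    ; f<l = f<l
    ; before-f = λ x a<x x<f e → before x a<x x<f (trans e Yf≡Yp)
    ; after-l = λ x l<x x<b e → after x l<x x<b (trans e Yl≡Yp)
    }
    where
    recolour : ∀ {x y c} → Y x ≡ Y y → Y y ≢ c → Y x ≢ c
    recolour Yx≡Yy Yy≢c e = Yy≢c (trans (sym Yx≡Yy) e)
    f<l : f < l
    f<l with Twinned.twins tw f (<⇒≤ a<f) (<⇒≤ (≤-<-trans f≤p p<b))
    ... | f′ , a≤f′ , f′≤b , f′≢f , Yf′≡Yf = <-≤-trans f<f′ f′≤l
      where
      Yf′≡Yp = trans Yf′≡Yf Yf≡Yp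
      a<f′ = ≤∧≢⇒< a≤f′ λ { refl → Yp≢Ya (sym Yf′≡Yp) }
      f′<b = ≤∧≢⇒< f′≤b λ { refl → Yp≢Yb (sym Yf′≡Yp) }
      f<f′ = ≤∧≢⇒< (≮⇒≥ λ f′<f → before f′ a<f′ f′<f Yf′≡Yp) (≢-sym f′≢f)
      f′≤l = ≮⇒≥ λ l<f′ → after f′ l<f′ f′<b Yf′≡Yp

  apex-triangulation : b ≤ m → Y a ≢ Y b → Third a b q → Good a q → Good q b → Σ (Triangulation a b) Proper
  apex-triangulation b≤m Ya≢Yb (between a<q q<b Yq≢Ya Yq≢Yb) good-a-q good-q-b =
    let (l , proper-l) = proper-triangulation a<q (≤-trans (<⇒≤ q<b) b≤m) (≢-sym Yq≢Ya) good-a-q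
        (r , proper-r) = proper-triangulation q<b b≤m Yq≢Yb good-q-b
    in join l r , proper-join Ya≢Yb proper-l proper-r

  -- Apexes f and l give two triangulations, with crossing arcs (f, b) and (a, l).
  two-apexes : b ≤ m → Twinned a b → (ex : Extremes a b) →
               (∃ λ r → Extremes.f ex < r × r < b × Y r ≡ Y a) →
               (∃ λ s → a < s × s < Extremes.l ex × Y s ≡ Y b) → TwoTriangulations a b
  two-apexes {b} {a} b≤m tw ex (r , f<r , r<b , Yr≡Ya) (s , a<s , s<l , Ys≡Yb) = record
    { t₁ = proj₁ apex-f ; t₂ = proj₁ apex-l ; proper₁ = proj₂ apex-f ; proper₂ = proj₂ apex-l
    ; lo = f ; hi = b ; long = ≤-trans (s≤s f<l) l<b
    ; arc₁ = right base
    ; ¬arc₂ = λ c → arcs-noncrossing (left base) c (inj₁ (a<f , f<l , l<b))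
    }
    where
    open Extremes ex
    open Twinned tw using (ends-differ)
    open Third third-f using () renaming (a<p to a<f; Yp≢Ya to Yf≢Ya)
    open Third third-l using () renaming (p<b to l<b; Yp≢Yb to Yl≢Yb)
    apex-f = apex-triangulation b≤m ends-differ third-f
               (good-up-to-first a<f (≤-trans (<⇒≤ (<-trans f<l l<b)) b≤m) before-f)
               (inj₂ (r , between f<r r<b (λ e → Yf≢Ya (trans (sym e) Yr≡Ya))
                                          (λ e → ends-differ (trans (sym Yr≡Ya) e))))
    apex-l = apex-triangulation b≤m ends-differ third-l
               (inj₂ (s , between a<s s<l (λ e → ends-differ (trans (sym e) Ys≡Yb))
                                          (λ e → Yl≢Yb (trans (sym e) Ys≡Yb))))
               (good-from-last l<b b≤m after-l)

  extend-right : Y a ≢ Y (suc b) → Y b ≢ Y (suc b) → TwoTriangulations a b → TwoTriangulations a (suc b)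
  extend-right Ya≢Y1+b Yb≢Y1+b two = record
    { t₁ = join t₁ edge ; t₂ = join t₂ edge
    ; proper₁ = proper-join Ya≢Y1+b proper₁ (proper-edge Yb≢Y1+b)
    ; proper₂ = proper-join Ya≢Y1+b proper₂ (proper-edge Yb≢Y1+b)
    ; lo = lo ; hi = hi ; long = long ; arc₁ = left arc₁
    ; ¬arc₂ = not-arc (proj₂ (proj₂ (arc-bounds arc₁))) long ¬arc₂
    }
    where
    open TwoTriangulations two
    not-arc : {t : Triangulation a b} → j ≤ b → 2 + k ≤ j → ¬ Arc t k j → ¬ Arc (join t edge) k j
    not-arc j≤b _ _ base = 1+n≰n j≤b
    not-arc _ _ ¬arc (left c) = ¬arc c
    not-arc _ 2+b≤1+b _ (right base) = 1+n≰n (≤-pred 2+b≤1+b)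

  extend-left : Y a ≢ Y b → Y a ≢ Y (suc a) → TwoTriangulations (suc a) b → TwoTriangulations a b
  extend-left Ya≢Yb Ya≢Y1+a two = record
    { t₁ = join edge t₁ ; t₂ = join edge t₂
    ; proper₁ = proper-join Ya≢Yb (proper-edge Ya≢Y1+a) proper₁
    ; proper₂ = proper-join Ya≢Yb (proper-edge Ya≢Y1+a) proper₂
    ; lo = lo ; hi = hi ; long = long ; arc₁ = right arc₁
    ; ¬arc₂ = not-arc (proj₁ (arc-bounds arc₁)) long ¬arc₂
    }
    where
    open TwoTriangulations two
    not-arc : {t : Triangulation (suc a) b} → suc a ≤ k → 2 + k ≤ j → ¬ Arc t k j → ¬ Arc (join edge t) k j
    not-arc 1+a≤a _ _ base = 1+n≰n 1+a≤a
    not-arc 1+a≤a _ _ (left base) = 1+n≰n 1+a≤a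
    not-arc _ _ ¬arc (right c) = ¬arc c

  -- Without the colour of a after f, the vertex b is an ear of every proper triangulation, and both
  -- a + 1 and f + 1 have the colour of b, so cutting b off leaves every vertex a twin.
  drop-last : suc b ≤ m → Twinned a (suc b) → (ex : Extremes a (suc b)) →
              (∀ r → Extremes.f ex < r → r < suc b → Y r ≢ Y a) → Twinned a b
  drop-last {b} {a} b<m tw ex no-a = record { ends-differ = Ya≢Yb ; third = suc f , third′ ; twins = twins′ }
    where
    open Extremes ex
    open Twinned tw
    open Third third-f using () renaming (a<p to a<f; Yp≢Ya to Yf≢Ya; Yp≢Yb to Yf≢Y1+b)
    f<b = <-≤-trans f<l (≤-pred (Third.p<b third-l))
    alternation = no-colour-after b<m ends-differ third-f f<b no-a
    Yb≡Yf = proj₁ alternation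
    third′ = proj₂ alternation
    open Third third′ using () renaming (p<b to 1+f<b; Yp≢Ya to Y1+f≢Ya; Yp≢Yb to Y1+f≢Yb)
    Ya≢Yb : Y a ≢ Y b
    Ya≢Yb e = Yf≢Ya (trans (sym Yb≡Yf) (sym e))
    1+a<f : suc a < f
    1+a<f with twins a ≤-refl (<⇒≤ (<-trans a<f (<-trans f<b (n<1+n b))))
    ... | a′ , a≤a′ , a′≤1+b , a′≢a , Ya′≡Ya = ≤-<-trans (≤∧≢⇒< a≤a′ (≢-sym a′≢a)) a′<f
      where
      a′<1+b = ≤∧≢⇒< a′≤1+b λ { refl → ends-differ (sym Ya′≡Ya) }
      a′<f = ≰⇒> λ f≤a′ → [ (λ f<a′ → no-a a′ f<a′ a′<1+b Ya′≡Ya) , (λ { refl → Yf≢Ya Ya′≡Ya }) ]′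
                          (m≤n⇒m<n∨m≡n f≤a′)
    Y1+a≡Y1+b = third-colour-unique (≢-sym Yf≢Ya) (≢-sym (adjacent a (<-trans (<-trans a<f f<b) b<m)))
                                    (before-f (suc a) (n<1+n a) 1+a<f) (≢-sym ends-differ) (≢-sym Yf≢Y1+b)
    Y1+f≡Y1+b = third-colour-unique (≢-sym Yf≢Ya) Y1+f≢Ya (λ e → Y1+f≢Yb (trans e (sym Yb≡Yf)))
                                    (≢-sym ends-differ) (≢-sym Yf≢Y1+b)
    twins′ : Twins a b
    twins′ x a≤x x≤b with Y x ≟ᶜ Y (suc b) | x ≟ suc a
    ... | yes Yx≡Y1+b | yes refl = suc f , ≤-trans (<⇒≤ a<f) (n≤1+n f) , <⇒≤ 1+f<b ,
                                   (λ e → <-irrefl (sym (suc-injective e)) a<f) ,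
                                   trans Y1+f≡Y1+b (sym Yx≡Y1+b)
    ... | yes Yx≡Y1+b | no x≢1+a = suc a , n≤1+n a , <⇒≤ (<-trans 1+a<f f<b) , ≢-sym x≢1+a ,
                                   trans Y1+a≡Y1+b (sym Yx≡Y1+b)
    ... | no Yx≢Y1+b | _ with twins x a≤x (m≤n⇒m≤1+n x≤b)
    ...   | x′ , a≤x′ , x′≤1+b , x′≢x , Yx′≡Yx =
            x′ , a≤x′ , ≤-pred (≤∧≢⇒< x′≤1+b λ { refl → Yx≢Y1+b (sym Yx′≡Yx) }) , x′≢x , Yx′≡Yx

  -- The mirror image of drop-last: here b and r (just before l) carry the colour of a.
  drop-first : suc b ≤ m → Twinned a (suc b) → (ex : Extremes a (suc b)) →
               (∀ s → a < s → s < Extremes.l ex → Y s ≢ Y (suc b)) → Twinned (suc a) (suc b)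
  drop-first {b} {a} b<m tw ex no-b =
    record { ends-differ = Y1+a≢Y1+b ; third = r , third′ ; twins = twins′ }
    where
    open Extremes ex
    open Twinned tw
    open Third third-l using () renaming (a<p to a<l; p<b to l<1+b; Yp≢Ya to Yl≢Ya; Yp≢Yb to Yl≢Y1+b)
    alternation = no-colour-before b<m ends-differ third-l (≤-<-trans (Third.a<p third-f) f<l) no-b
    Y1+a≡Yl = proj₁ alternation
    r = proj₁ (proj₂ alternation)
    r<l = proj₁ (proj₂ (proj₂ alternation))
    third′ = proj₂ (proj₂ (proj₂ alternation))
    open Third third′ using () renaming (a<p to 1+a<r; Yp≢Ya to Yr≢Y1+a; Yp≢Yb to Yr≢Y1+b)
    Y1+a≢Y1+b : Y (suc a) ≢ Y (suc b)
    Y1+a≢Y1+b e = Yl≢Y1+b (trans (sym Y1+a≡Yl) e)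
    l<b : l < b
    l<b with twins (suc b) (<⇒≤ (<-trans a<l l<1+b)) ≤-refl
    ... | b′ , a≤b′ , b′≤1+b , b′≢1+b , Yb′≡Y1+b = <-≤-trans l<b′ (≤-pred (≤∧≢⇒< b′≤1+b b′≢1+b))
      where
      l<b′ = ≰⇒> λ b′≤l → [ (λ b′<l → no-b b′ (≤∧≢⇒< a≤b′ λ { refl → ends-differ Yb′≡Y1+b }) b′<l Yb′≡Y1+b)
                          , (λ { refl → Yl≢Y1+b Yb′≡Y1+b }) ]′ (m≤n⇒m<n∨m≡n b′≤l)
    Yb≡Ya = third-colour-unique Yl≢Y1+b (after-l b l<b (n<1+n b)) (adjacent b b<m) (≢-sym Yl≢Ya) ends-differ
    Yr≡Ya = third-colour-unique Yl≢Y1+b (λ e → Yr≢Y1+a (trans e (sym Y1+a≡Yl))) Yr≢Y1+b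
                                (≢-sym Yl≢Ya) ends-differ
    twins′ : Twins (suc a) (suc b)
    twins′ x 1+a≤x x≤1+b with Y x ≟ᶜ Y a | x ≟ b
    ... | yes Yx≡Ya | yes refl = r , <⇒≤ 1+a<r , <⇒≤ (<-trans r<l (<-trans l<b (n<1+n b))) ,
                                 <⇒≢ (<-trans r<l l<b) , trans Yr≡Ya (sym Yx≡Ya)
    ... | yes Yx≡Ya | no x≢b = b , ≤-trans (<⇒≤ 1+a<r) (<⇒≤ (<-trans r<l l<b)) , n≤1+n b , ≢-sym x≢b ,
                               trans Yb≡Ya (sym Yx≡Ya)
    ... | no Yx≢Ya | _ with twins x (≤-trans (n≤1+n a) 1+a≤x) x≤1+b
    ...   | x′ , a≤x′ , x′≤1+b , x′≢x , Yx′≡Yx =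
            x′ , ≤∧≢⇒< a≤x′ (λ { refl → Yx≢Ya (sym Yx′≡Yx) }) , x′≤1+b , x′≢x , Yx′≡Yx

  two-triangulations : b ≤ m → Twinned a b → TwoTriangulations a b
  two-triangulations {b} {a} = sized b (m≤m+n b a)
    where
    sized : ∀ {a b} n → b ≤ n + a → b ≤ m → Twinned a b → TwoTriangulations a b
    sized zero b≤a _ tw = contradiction b≤a (<⇒≱ (twinned-< tw))
    sized {b = zero} (suc n) _ _ tw = contradiction (twinned-< tw) λ ()
    sized {a} {suc b} (suc n) bound b≤m tw = split (extremes tw)
      where
      split : Extremes a (suc b) → TwoTriangulations a (suc b)
      split ex with colour-between? (Y a) (Extremes.f ex) (suc b)
                  | colour-between? (Y (suc b)) a (Extremes.l ex)
      ... | inj₂ no-a | _ =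
            extend-right (Twinned.ends-differ tw) (adjacent b b≤m)
              (sized n (size-left {k = n} bound (n<1+n b)) (<⇒≤ b≤m) (drop-last b≤m tw ex no-a))
      ... | inj₁ _ | inj₂ no-b =
            extend-left (Twinned.ends-differ tw) (adjacent a (<-≤-trans (twinned-< tw) b≤m))
              (sized n (size-right {k = n} bound (n<1+n a)) b≤m (drop-first b≤m tw ex no-b))
      ... | inj₁ r | inj₁ s = two-apexes b≤m tw ex r s

witness : ∀ {A : Set} (d : Dec A) → does d ≡ true → A
witness (yes a) _ = a

module Fiber {m : ℕ} (x : X m) where
  open X x using (y; y-first; y-last; y-adj)

  vertex : k ≤ m → ∃ λ (u : Fin (suc m)) → toℕ u ≡ k
  vertex k≤m = fromℕ< (s≤s k≤m) , Fin.toℕ-fromℕ< (s≤s k≤m)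

  toℕ≤m : (u : Fin (suc m)) → toℕ u ≤ m
  toℕ≤m = Fin.toℕ≤pred[n]

  arc-vertices : {t : Triangulation 0 m} → Arc t k j → ∃₂ λ u v → toℕ u ≡ k × toℕ v ≡ j
  arc-vertices c with arc-bounds c
  ... | _ , k<j , j≤m with vertex (≤-trans (<⇒≤ k<j) j≤m) | vertex j≤m
  ... | u , u≡k | v , v≡j = u , v , u≡k , v≡j

  -- The colouring read on vertex numbers; the value beyond m is never used.
  Y : ℕ → F2P1
  Y n with n <? suc m
  ... | yes n<1+m = y (fromℕ< n<1+m)
  ... | no _ = 𝟎

  Y-toℕ : ∀ u → Y (toℕ u) ≡ y u
  Y-toℕ u with toℕ u <? suc m
  ... | yes u<1+m = cong y (Fin.fromℕ<-toℕ u u<1+m)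
  ... | no u≮1+m = contradiction (Fin.toℕ<n u) u≮1+m

  adjacent : ∀ n → n < m → Y n ≢ Y (suc n)
  adjacent n n<m Yn≡Y1+n = y-adj i (begin
      y (inject₁ i)           ≡⟨ Y-toℕ (inject₁ i) ⟨
      Y (toℕ (inject₁ i))     ≡⟨ cong Y (trans (Fin.toℕ-inject₁ i) (Fin.toℕ-fromℕ< n<m)) ⟩
      Y n                     ≡⟨ Yn≡Y1+n ⟩
      Y (suc n)               ≡⟨ cong (Y ∘ suc) (Fin.toℕ-fromℕ< n<m) ⟨
      Y (toℕ (fsuc i))        ≡⟨ Y-toℕ (fsuc i) ⟩
      y (fsuc i)              ∎)
    where
    open ≡-Reasoning
    i = fromℕ< n<m

  Y0≡𝟎 : Y 0 ≡ 𝟎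
  Y0≡𝟎 = trans (Y-toℕ fzero) y-first

  Ym≡∞ : Y m ≡ ∞
  Ym≡∞ = trans (cong Y (sym (Fin.toℕ-fromℕ m))) (trans (Y-toℕ (fromℕ m)) y-last)

  Y0≢Ym : Y 0 ≢ Y m
  Y0≢Ym e with trans (sym Y0≡𝟎) (trans e Ym≡∞)
  ... | ()

  open Colouring Y
  open ProperColouring Y adjacent

  diagonal? : ∀ k j → Dec (Diagonal m k j)
  diagonal? k j = (2 + k ≤? j) ×-dec ¬? ((k ≟ 0) ×-dec (j ≟ m))

  ⟦_⟧ : Triangulation 0 m → DiagSet m
  ⟦ t ⟧ u v = does (arc? t (toℕ u) (toℕ v) ×-dec diagonal? (toℕ u) (toℕ v))

  chord : (t : Triangulation 0 m) → ∀ u v → ⟦ t ⟧ u v ≡ true → Arc t (toℕ u) (toℕ v) × IsDiagonal m u v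
  chord t u v = witness (arc? t (toℕ u) (toℕ v) ×-dec diagonal? (toℕ u) (toℕ v))

  chord-intro : (t : Triangulation 0 m) → ∀ u v → Arc t (toℕ u) (toℕ v) → IsDiagonal m u v → ⟦ t ⟧ u v ≡ true
  chord-intro t u v c diag = dec-true (arc? t (toℕ u) (toℕ v) ×-dec diagonal? (toℕ u) (toℕ v)) (c , diag)

  realize : {t : Triangulation 0 m} → Proper t → InFiber x ⟦ t ⟧
  realize {t} proper = triangulation , proper-chords
    where
    maximal : ∀ u v → IsDiagonal m u v → ¬ ⟦ t ⟧ u v ≡ true →
              ∃ λ u′ → ∃ λ v′ → ⟦ t ⟧ u′ v′ ≡ true × Crosses u v u′ v′
    maximal u v diag ∉t with arcs-maximal t z≤n (<-trans (n<1+n _) (proj₁ diag)) (toℕ≤m v)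
    ... | inj₁ c = contradiction (chord-intro t u v c diag) ∉t
    ... | inj₂ (_ , _ , c′ , cross) with arc-vertices c′
    ... | u′ , v′ , refl , refl = u′ , v′ , chord-intro t u′ v′ c′ (crossing-diagonal cross (toℕ≤m v)) , cross
    triangulation : IsTriangulation m ⟦ t ⟧
    triangulation = record
      { only-diagonals = λ u v → proj₂ ∘ chord t u v
      ; non-crossing = λ u v u′ v′ in₁ in₂ →
                         arcs-noncrossing (proj₁ (chord t u v in₁)) (proj₁ (chord t u′ v′ in₂))
      ; maximal = maximal
      }
    proper-chords : MapsTo ⟦ t ⟧ x
    proper-chords u v in-t yu≡yv =
      proper (proj₁ (chord t u v in-t)) (trans (Y-toℕ u) (trans yu≡yv (sym (Y-toℕ v))))

  0<m : 0 < m
  0<m = ≤∧≢⇒< z≤n (λ 0≡m → Y0≢Ym (cong Y 0≡m))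

  module Decomposition {T : DiagSet m} (tri : IsTriangulation m T) (maps : MapsTo T x) where
    open IsTriangulation tri

    Edge : Fin (suc m) → Fin (suc m) → Set
    Edge u v = toℕ v ≡ suc (toℕ u) ⊎ T u v ≡ true ⊎ (toℕ u ≡ 0 × toℕ v ≡ m)

    EdgeAt : ℕ → ℕ → Set
    EdgeAt k j = ∀ {u v} → toℕ u ≡ k → toℕ v ≡ j → Edge u v

    edge-at : ∀ {u v} → Edge u v → EdgeAt (toℕ u) (toℕ v)
    edge-at e u′≡u v′≡v = subst₂ Edge (sym (Fin.toℕ-injective u′≡u)) (sym (Fin.toℕ-injective v′≡v)) e

    edge-uncrossed : ∀ {u v u′ v′} → Edge u v → T u′ v′ ≡ true → ¬ Crosses u v u′ v′
    edge-uncrossed {u′ = u′} (inj₁ v≡1+u) _ (inj₁ (u<u′ , u′<v , _)) =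
      ≤⇒≯ (≤-pred (subst (toℕ u′ <_) v≡1+u u′<v)) u<u′
    edge-uncrossed {v′ = v′} (inj₁ v≡1+u) _ (inj₂ (_ , u<v′ , v′<v)) =
      ≤⇒≯ (≤-pred (subst (toℕ v′ <_) v≡1+u v′<v)) u<v′
    edge-uncrossed (inj₂ (inj₁ Tuv)) Tu′v′ = non-crossing _ _ _ _ Tuv Tu′v′
    edge-uncrossed {v′ = v′} (inj₂ (inj₂ (_ , v≡m))) _ (inj₁ (_ , _ , v<v′)) =
      ≤⇒≯ (toℕ≤m v′) (subst (_< toℕ v′) v≡m v<v′)
    edge-uncrossed {u′ = u′} (inj₂ (inj₂ (u≡0 , _))) _ (inj₂ (u′<u , _)) =
      contradiction (subst (toℕ u′ <_) u≡0 u′<u) λ ()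

    edge-coloured : ∀ {u v} → Edge u v → Y (toℕ u) ≢ Y (toℕ v)
    edge-coloured {u} {v} (inj₁ v≡1+u) e =
      adjacent (toℕ u) (subst (_≤ m) v≡1+u (toℕ≤m v)) (trans e (cong Y v≡1+u))
    edge-coloured {u} {v} (inj₂ (inj₁ Tuv)) e = maps u v Tuv (trans (sym (Y-toℕ u)) (trans e (Y-toℕ v)))
    edge-coloured (inj₂ (inj₂ (u≡0 , v≡m))) e = Y0≢Ym (subst₂ (λ k j → Y k ≡ Y j) u≡0 v≡m e)

    -- Walk p along the vertices joined to a until p is also joined to b.
    apex-walk : ∀ n {a b p} → toℕ b ≤ n + toℕ p → Edge a b → toℕ a < toℕ p → toℕ p < toℕ b → Edge a p →
                ∃ λ p → toℕ a < toℕ p × toℕ p < toℕ b × Edge a p × Edge p b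
    apex-walk zero b≤p _ _ p<b _ = contradiction b≤p (<⇒≱ p<b)
    apex-walk (suc n) {a} {b} {p} bound ab a<p p<b ap with toℕ b ≟ suc (toℕ p) | T p b in Tpb
    ... | yes b≡1+p | _ = p , a<p , p<b , ap , inj₁ b≡1+p
    ... | no _ | true = p , a<p , p<b , ap , inj₂ (inj₁ Tpb)
    ... | no b≢1+p | false
      with maximal p b (≤∧≢⇒< p<b (≢-sym b≢1+p) , λ (p≡0 , _) → contradiction (subst (toℕ a <_) p≡0 a<p) λ ())
                       (λ Tpb≡true → contradiction (trans (sym Tpb) Tpb≡true) λ ())
    ... | k , l , Tkl , inj₁ (p<k , k<b , b<l) =
          contradiction (inj₁ (<-trans a<p p<k , k<b , b<l)) (edge-uncrossed ab Tkl)
    ... | k , l , Tkl , inj₂ (k<p , p<l , l<b) with <-cmp (toℕ k) (toℕ a)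
    ...   | tri< k<a _ _ = contradiction (inj₂ (k<a , <-trans a<p p<l , l<b)) (edge-uncrossed ab Tkl)
    ...   | tri> _ _ a<k = contradiction (inj₁ (a<k , k<p , p<l)) (edge-uncrossed ap Tkl)
    ...   | tri≈ _ k≡a _ = apex-walk n (size-right {k = n} bound p<l) ab (<-trans a<p p<l) l<b
                                     (inj₂ (inj₁ (subst (λ w → T w l ≡ true) (Fin.toℕ-injective k≡a) Tkl)))

    apex : ∀ {a b} → Edge a b → 2 + toℕ a ≤ toℕ b →
           ∃ λ p → toℕ a < toℕ p × toℕ p < toℕ b × Edge a p × Edge p b
    apex {a} {b} ab 2+a≤b with vertex (≤-trans (<⇒≤ 2+a≤b) (toℕ≤m b))
    ... | p , p≡1+a = apex-walk (toℕ b) (m≤m+n (toℕ b) (toℕ p)) ab (≤-reflexive (sym p≡1+a))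
                                (subst (_< toℕ b) (sym p≡1+a) 2+a≤b) (inj₁ p≡1+a)

    decompose : ∀ n {k j} → j ≤ n + k → k < j → j ≤ m → EdgeAt k j →
                Σ (Triangulation k j) λ t → ∀ {k′ j′} → Arc t k′ j′ → EdgeAt k′ j′
    decompose zero j≤k k<j _ _ = contradiction j≤k (<⇒≱ k<j)
    decompose (suc n) {k} {j} bound k<j j≤m kj with j ≟ suc k
    ... | yes refl = edge , λ { base → kj }
    ... | no j≢1+k with vertex (≤-trans (<⇒≤ k<j) j≤m) | vertex j≤m
    ... | u , refl | v , refl with apex (kj refl refl) (≤∧≢⇒< k<j (≢-sym j≢1+k))
    ... | p , u<p , p<v , up , pv =
          join (proj₁ below) (proj₁ above) ,
          λ { base → kj ; (left c) → proj₂ below c ; (right c) → proj₂ above c }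
      where
      below = decompose n (size-left {k = n} bound p<v) u<p (toℕ≤m p) (edge-at up)
      above = decompose n (size-right {k = n} bound u<p) p<v j≤m (edge-at pv)

    decomposition : Σ (Triangulation 0 m) λ t → Proper t × (∀ u v → T u v ≡ ⟦ t ⟧ u v)
    decomposition = t , proper , λ u v → ⇔→≡ (mk⇔ (to u v) (from u v))
      where
      tree = decompose m (≤-reflexive (sym (+-identityʳ m))) 0<m ≤-refl λ u≡0 v≡m → inj₂ (inj₂ (u≡0 , v≡m))
      t = proj₁ tree
      arc-edge = proj₂ tree
      proper : Proper t
      proper c with arc-vertices c
      ... | _ , _ , refl , refl = edge-coloured (arc-edge c refl refl)
      to : ∀ u v → T u v ≡ true → ⟦ t ⟧ u v ≡ true
      to u v Tuv with arcs-maximal t z≤n (<-trans (n<1+n _) (proj₁ (only-diagonals u v Tuv))) (toℕ≤m v)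
      ... | inj₁ c = chord-intro t u v c (only-diagonals u v Tuv)
      ... | inj₂ (_ , _ , c′ , cross) with arc-vertices c′
      ...   | _ , _ , refl , refl =
                  contradiction (crossing-sym cross) (edge-uncrossed (arc-edge c′ refl refl) Tuv)
      from : ∀ u v → ⟦ t ⟧ u v ≡ true → T u v ≡ true
      from u v in-t with chord t u v in-t
      ... | c , 2+u≤v , not-outer with arc-edge c refl refl
      ...   | inj₁ v≡1+u = contradiction (subst (2 + toℕ u ≤_) v≡1+u 2+u≤v) 1+n≰n
      ...   | inj₂ (inj₁ Tuv) = Tuv
      ...   | inj₂ (inj₂ outer) = contradiction outer not-outer

  coloured-𝟏 : ∀ i → y i ≡ 𝟏 → ∃ (Third 0 m)
  coloured-𝟏 i yi≡𝟏 = toℕ i , between 0<i i<m (λ e → 𝟏≢𝟎 (trans (sym Yi≡𝟏) (trans e Y0≡𝟎)))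
                                               (λ e → 𝟏≢∞ (trans (sym Yi≡𝟏) (trans e Ym≡∞)))
    where
    Yi≡𝟏 = trans (Y-toℕ i) yi≡𝟏
    𝟏≢𝟎 : 𝟏 ≢ 𝟎
    𝟏≢𝟎 ()
    𝟏≢∞ : 𝟏 ≢ ∞
    𝟏≢∞ ()
    0<i = ≤∧≢⇒< z≤n λ 0≡i → 𝟏≢𝟎 (trans (sym Yi≡𝟏) (trans (cong Y (sym 0≡i)) Y0≡𝟎))
    i<m = ≤∧≢⇒< (toℕ≤m i) λ i≡m → 𝟏≢∞ (trans (sym Yi≡𝟏) (trans (cong Y i≡m) Ym≡∞))

  UniqueColour : Fin (suc m) → Set
  UniqueColour i = ∀ j → j ≢ i → y i ≢ y j

  differs? : ∀ i j → Dec (j ≢ i → y i ≢ y j)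
  differs? i j = ¬? (j Fin.≟ i) →-dec ¬? (y i ≟ᶜ y j)

  unique-colour? : ∀ i → Dec (UniqueColour i)
  unique-colour? i = Fin.all? (differs? i)

  fiber-inhabited : ∃ (Third 0 m) → ∃ (InFiber x)
  fiber-inhabited third =
    let (t , proper) = proper-triangulation 0<m ≤-refl Y0≢Ym (inj₂ third) in ⟦ t ⟧ , realize proper

  fiber-unique : ∀ {i} → UniqueColour i → ∀ T T′ → InFiber x T → InFiber x T′ → SameTriangulation T T′
  fiber-unique {i} unique T T′ (tri , maps) (tri′ , maps′) u v =
    let (t , proper , T≡t) = Decomposition.decomposition tri maps
        (t′ , proper′ , T′≡t′) = Decomposition.decomposition tri′ maps′
    in begin
      T u v      ≡⟨ T≡t u v ⟩
      ⟦ t ⟧ u v  ≡⟨ ⇔→≡ (mk⇔ (transfer proper proper′) (transfer proper′ proper)) ⟩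
      ⟦ t′ ⟧ u v ≡⟨ T′≡t′ u v ⟨
      T′ u v     ∎
    where
    open ≡-Reasoning
    unique-ℕ : ∀ n → n ≤ m → Y n ≡ Y (toℕ i) → n ≡ toℕ i
    unique-ℕ n n≤m Yn≡Yi with vertex n≤m
    ... | w , refl with w Fin.≟ i
    ...   | yes refl = refl
    ...   | no w≢i = contradiction (trans (sym (Y-toℕ i)) (trans (sym Yn≡Yi) (Y-toℕ w))) (unique w w≢i)
    open Fan unique-ℕ
    transfer : {t t′ : Triangulation 0 m} → Proper t → Proper t′ → ⟦ t ⟧ u v ≡ true → ⟦ t′ ⟧ u v ≡ true
    transfer {t} {t′} proper proper′ in-t =
      let (c , diag) = chord t u v in-t in chord-intro t′ u v (diagonal-arcs-agree proper proper′ c diag) diag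

  twinned : ∃ (Third 0 m) → ¬ ∃ UniqueColour → Twinned 0 m
  twinned third none = record { ends-differ = Y0≢Ym ; third = third ; twins = twins }
    where
    partner : ∀ u → ∃ λ w → w ≢ u × y u ≡ y w
    partner u with Fin.¬∀⟶∃¬ (suc m) _ (differs? u) (λ all → none (u , all))
    ... | w , ¬distinct with y u ≟ᶜ y w
    ...   | yes yu≡yw = w , (λ w≡u → ¬distinct λ w≢u → contradiction w≡u w≢u) , yu≡yw
    ...   | no yu≢yw = contradiction (λ _ → yu≢yw) ¬distinct
    twins : Twins 0 m
    twins n _ n≤m with vertex n≤m
    ... | u , refl with partner u
    ...   | w , w≢u , yu≡yw = toℕ w , z≤n , toℕ≤m w , w≢u ∘ Fin.toℕ-injective ,
                              trans (Y-toℕ w) (trans (sym yu≡yw) (sym (Y-toℕ u)))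

  distinct-realizations : {t₁ t₂ : Triangulation 0 m} → Arc t₁ k j → ¬ Arc t₂ k j → 2 + k ≤ j →
                          ¬ SameTriangulation ⟦ t₁ ⟧ ⟦ t₂ ⟧
  distinct-realizations {t₁ = t₁} {t₂} c ¬c 2+k≤j same with arc-vertices c
  ... | u , v , refl , refl =
        ¬c (proj₁ (chord t₂ u v (trans (sym (same u v)) (chord-intro t₁ u v c diag))))
    where
    diag : IsDiagonal m u v
    diag = 2+k≤j , λ (u≡0 , v≡m) → ¬c (subst₂ (Arc t₂) (sym u≡0) (sym v≡m) base)

  fiber-not-singleton : Twinned 0 m → ¬ FiberHasOneElement x
  fiber-not-singleton tw (_ , one) =
    distinct-realizations arc₁ ¬arc₂ long (one _ _ (realize proper₁) (realize proper₂))
    where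
    open TwoTriangulations (two-triangulations ≤-refl tw)

corollary3p9 : (m : ℕ) → 1 ≤ m → (x : X m) → ∃ (λ i → X.y x i ≡ 𝟏) →
    (FiberHasOneElement x ⇔ ∃ (λ i → ∀ j → j ≢ i → X.y x i ≢ X.y x j))
corollary3p9 m _ x (i , yi≡𝟏) = mk⇔ forward backward
  where
  open Fiber x
  third = coloured-𝟏 i yi≡𝟏
  backward : ∃ UniqueColour → FiberHasOneElement x
  backward (_ , unique) = fiber-inhabited third , fiber-unique unique
  forward : FiberHasOneElement x → ∃ UniqueColour
  forward one with Fin.any? unique-colour?
  ... | yes found = found
  ... | no none = contradiction one (fiber-not-singleton (twinned third none))
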